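{- In the setting described in the context, suppose $N$ is even. Then $\theta$ is even in each of the following cases: (a) $B^2\equiv D+4N\pmod{8N}$; (b) $B^2\equiv D\pmod{8N}$ and $D\equiv1\pmod8$.
   Context: Setting: Let $N>1$ be an integer, $N=2^{\lambda(N)}N_1$ with $N_1$ odd. Let $D=c^2\Delta<0$ be a discriminant with fundamental part $\Delta$ and conductor $c$, $K=\mathbb Q(\sqrt D)$, $\mathcal O$ the order of discriminant $D$. Let $[A,B,C]$ be a primitive positive definite integral quadratic form with $B^2-4AC=D$, $\gcd(A,N)=1$ and $N\mid C$. Let $\alpha=\frac{ -B+\sqrt D}{2A}$, so $\mathcal O=\mathbb Z+\mathbb Z A\alpha$. Let $u,v\in\mathbb Z$ be such that $\pi=u+vA\alpha$ has norm $p=u^2-uvB+v^2AC$ a prime number not dividing $6cN$ that splits in $\mathcal O$, and assume $p\mid C$ and $p\mid u$. Set $u'=u-vB$. Let $v_1$, $A_1$ be the odd parts of $v$, $A$ ($v_1=1$ if $v=0$). Define the integer $\theta=(N-1)v\left(u'\frac{C}{Np}+A\left(\frac up(1-u'^2)-u'\right)\right)+3v_1A_1(N_1-1)(u'-1)+\frac{3\lambda(N)(u'^2-1)}{2}.$ -}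

module Defs where

open import Data.Nat as ℕ using (ℕ)
open import Data.Integer
open import Data.Integer.Divisibility using (_∣_)
open import Data.Product using (∃; _×_; _,_)
open import Data.Sum using (_⊎_)
open import Relation.Binary.PropositionalEquality using (_≡_)
open import Relation.Nullary using (¬_)

infix 4 _≡_[mod_]
_≡_[mod_] : ℤ → ℤ → ℤ → Set
a ≡ b [mod m ] = m ∣ (a - b)

Odd : ℤ → Set
Odd n = ¬ (+ 2 ∣ n)

Even : ℤ → Set
Even n = + 2 ∣ n

SquareFree : ℤ → Set
SquareFree n = ∀ (d : ℕ) → (+ d * + d) ∣ n → d ≡ 1

FundamentalDiscriminant : ℤ → Set
FundamentalDiscriminant Δ =
  ¬ (Δ ≡ + 1) ×
  ((Δ ≡ + 1 [mod + 4 ] × SquareFree Δ)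
   ⊎ ∃ λ m → Δ ≡ + 4 * m × (m ≡ + 2 [mod + 4 ] ⊎ m ≡ + 3 [mod + 4 ]) × SquareFree m)

IsOddPart : ℤ → ℤ → Set
IsOddPart v w = (v ≡ + 0 × w ≡ + 1) ⊎ ∃ λ (k : ℕ) → v ≡ + (2 ℕ.^ k) * w × Odd w

-- a prime p (not dividing the conductor, p odd) splits in the order of
-- discriminant D: D is a nonzero square modulo p
SplitsIn : ℤ → ℤ → Set
SplitsIn D p = ¬ (p ∣ D) × ∃ λ x → x * x ≡ D [mod p ]

-- twice θ, where q₁ = C/(Np), q₂ = u/p, u' = u - vB, λN = λ(N)
twoθ : (N N₁ : ℤ) (λN : ℕ) (A B v v₁ A₁ u q₁ q₂ : ℤ) → ℤ
twoθ N N₁ λN A B v v₁ A₁ u q₁ q₂ =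
  let u' = u - v * B in
  + 2 * ((N - + 1) * v * (u' * q₁ + A * (q₂ * (+ 1 - u' * u') - u')))
  + + 6 * v₁ * A₁ * (N₁ - + 1) * (u' - + 1)
  + + 3 * + λN * (u' * u' - + 1)

{-# OPTIONS --safe #-}

-- The prime p is odd, since an even prime would divide 6cN. As N is even and N ∣ C,
-- p = u u′ + v²AC ≡ u u′ (mod 2), so u and u′ = u − vB are odd. Then 2(u′ − 1) and
-- u′² − 1 are divisible by 4, and writing q₁ = C/(Np), the first term of 2θ is
-- 2(N − 1)(u′ · v(q₁ − A) − vAq₂(u′² − 1)); so 4 ∣ 2θ once v(q₁ − A) is even.
-- In case (a), 8N ∣ B² − D − 4N = 4N(Aq₁p − 1) makes A and q₁ odd, so q₁ − A is even.
-- In case (b), D is odd, hence so is B, and vB = u − u′ is even, so v is even.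

module Submission where

open import Defs
open import Data.Nat as ℕ using (ℕ)
open import Data.Nat.Primality using (Prime)
open import Data.Integer
open import Data.Integer.Divisibility using (_∣_)
open import Data.Integer.GCD using (gcd)
open import Data.Product using (_×_)
open import Data.Sum using (_⊎_)
open import Relation.Binary.PropositionalEquality using (_≡_)
open import Relation.Nullary using (¬_)

open import Data.Empty using (⊥-elim)
open import Data.Integer.DivMod using (_%_; _/_; n%d<d; a≡a%n+[a/n]*n)
open import Data.Integer.Divisibility.Signed
  using (divides; ∣-trans; ∣ᵤ⇒∣; ∣⇒∣ᵤ; ∣m⇒∣m*n; ∣n⇒∣m*n; ∣m∣n⇒∣m+n;
         ∣m∣n⇒∣m-n; *-monoʳ-∣; *-monoˡ-∣; *-cancelˡ-∣; module ∣-Reasoning)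
  renaming (_∣_ to _∣ₛ_)
open import Data.Integer.Properties using (+-identityˡ; +-comm; <-trans)
open import Data.Integer.Tactic.RingSolver using (solve)
open import Data.List using (_∷_; [])
open import Data.Nat.Divisibility using (∣1⇒≡1)
open import Data.Nat.Primality using (prime⇒irreducible)
open import Data.Product using (∃; _,_)
open import Data.Sum using (inj₁; inj₂)
open import Function using (case_of_)
open import Relation.Binary.PropositionalEquality using (refl; sym; trans; subst)

2∤1 : ¬ (+ 2 ∣ₛ + 1)
2∤1 2∣1 with ∣1⇒≡1 (∣⇒∣ᵤ 2∣1)
... | ()

2∣m-1⇒2∤m : ∀ {m} → + 2 ∣ₛ m - + 1 → ¬ (+ 2 ∣ₛ m)
2∣m-1⇒2∤m {m} 2∣m-1 2∣m = 2∤1 (begin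
  + 2            ∣⟨ ∣m∣n⇒∣m-n 2∣m 2∣m-1 ⟩
  m - (m - + 1)  ≡⟨ solve (m ∷ []) ⟩
  + 1            ∎)
  where open ∣-Reasoning

2∤m⇒m≡2q+1 : ∀ {m} → ¬ (+ 2 ∣ₛ m) → ∃ λ q → m ≡ q * + 2 + + 1
2∤m⇒m≡2q+1 {m} 2∤m with m % + 2 | n%d<d m (+ 2) | a≡a%n+[a/n]*n m (+ 2)
... | 0 | _ | m≡0+q*2 = ⊥-elim (2∤m (divides (m / + 2) (trans m≡0+q*2 (+-identityˡ (m / + 2 * + 2)))))
... | 1 | _ | m≡1+q*2 = m / + 2 , trans m≡1+q*2 (+-comm (+ 1) (m / + 2 * + 2))
... | ℕ.suc (ℕ.suc _) | ℕ.s≤s (ℕ.s≤s ()) | _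

2∤m⇒2∣m-1 : ∀ {m} → ¬ (+ 2 ∣ₛ m) → + 2 ∣ₛ m - + 1
2∤m⇒2∣m-1 2∤m with 2∤m⇒m≡2q+1 2∤m
... | q , refl = begin
  + 2                  ∣⟨ divides q refl ⟩
  q * + 2              ≡⟨ solve (q ∷ []) ⟩
  q * + 2 + + 1 - + 1  ∎
  where open ∣-Reasoning

2∤m⇒4∣m*m-1 : ∀ {m} → ¬ (+ 2 ∣ₛ m) → + 4 ∣ₛ m * m - + 1
2∤m⇒4∣m*m-1 2∤m with 2∤m⇒m≡2q+1 2∤m
... | q , refl = begin
  + 4                                      ∣⟨ divides (q * q + q) refl ⟩
  (q * q + q) * + 4                        ≡⟨ solve (q ∷ []) ⟩
  (q * + 2 + + 1) * (q * + 2 + + 1) - + 1  ∎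
  where open ∣-Reasoning

2∣m⇒2∣n⇒4∣m*n : ∀ {m n} → + 2 ∣ₛ m → + 2 ∣ₛ n → + 4 ∣ₛ m * n
2∣m⇒2∣n⇒4∣m*n {m} {n} 2∣m 2∣n = begin
  + 2 * + 2  ∣⟨ *-monoʳ-∣ (+ 2) 2∣n ⟩
  + 2 * n    ∣⟨ *-monoˡ-∣ n 2∣m ⟩
  m * n      ∎
  where open ∣-Reasoning

2∤m*n⇒2∤m : ∀ {m} n → ¬ (+ 2 ∣ₛ m * n) → ¬ (+ 2 ∣ₛ m)
2∤m*n⇒2∤m n 2∤m*n 2∣m = 2∤m*n (∣m⇒∣m*n n 2∣m)

2∤m*n⇒2∤n : ∀ m {n} → ¬ (+ 2 ∣ₛ m * n) → ¬ (+ 2 ∣ₛ n)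
2∤m*n⇒2∤n m 2∤m*n 2∣n = 2∤m*n (∣n⇒∣m*n m 2∣n)

2∤m⇒2∤n⇒2∣m-n : ∀ {m n} → ¬ (+ 2 ∣ₛ m) → ¬ (+ 2 ∣ₛ n) → + 2 ∣ₛ m - n
2∤m⇒2∤n⇒2∣m-n 2∤m 2∤n with 2∤m⇒m≡2q+1 2∤m | 2∤m⇒m≡2q+1 2∤n
... | q , refl | r , refl = begin
  + 2                              ∣⟨ divides (q - r) refl ⟩
  (q - r) * + 2                    ≡⟨ solve (q ∷ r ∷ []) ⟩
  q * + 2 + + 1 - (r * + 2 + + 1)  ∎
  where open ∣-Reasoning

2∣m*n⇒2∤n⇒2∣m : ∀ {m n} → + 2 ∣ₛ m * n → ¬ (+ 2 ∣ₛ n) → + 2 ∣ₛ m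
2∣m*n⇒2∤n⇒2∣m {m} 2∣m*n 2∤n with 2∤m⇒m≡2q+1 2∤n
... | r , refl = begin
  + 2                                ∣⟨ ∣m∣n⇒∣m-n 2∣m*n (divides (m * r) refl) ⟩
  m * (r * + 2 + + 1) - m * r * + 2  ≡⟨ solve (m ∷ r ∷ []) ⟩
  m                                  ∎
  where open ∣-Reasoning

even-prime∣even : ∀ {p m} → Prime ∣ p ∣ → + 2 ∣ₛ p → + 2 ∣ₛ m → p ∣ m
even-prime∣even {m = m} p-prime 2∣p 2∣m with prime⇒irreducible p-prime (∣⇒∣ᵤ 2∣p)
... | inj₂ 2≡∣p∣ = subst (λ d → + d ∣ m) 2≡∣p∣ (∣⇒∣ᵤ 2∣m)

2∤norm⇒2∤u*u′ : ∀ u v A B C → + 2 ∣ₛ C →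
  ¬ (+ 2 ∣ₛ u * u - u * v * B + v * v * A * C) → ¬ (+ 2 ∣ₛ u * (u - v * B))
2∤norm⇒2∤u*u′ u v A B C 2∣C 2∤norm 2∣u*u′ = 2∤norm (begin
  + 2                                ∣⟨ ∣m∣n⇒∣m+n 2∣u*u′ (∣n⇒∣m*n (v * v * A) 2∣C) ⟩
  u * (u - v * B) + v * v * A * C    ≡⟨ solve (u ∷ v ∷ A ∷ B ∷ C ∷ []) ⟩
  u * u - u * v * B + v * v * A * C  ∎)
  where open ∣-Reasoning

B²≡D+4N⇒2∣q₁-A : ∀ N A B p q₁ {C D} .{{_ : NonZero N}} →
  C ≡ q₁ * (N * p) → B * B - + 4 * A * C ≡ D →
  B * B ≡ D + + 4 * N [mod + 8 * N ] → + 2 ∣ₛ q₁ - A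
B²≡D+4N⇒2∣q₁-A N A B p q₁ refl refl B²≡D+4N =
  2∤m⇒2∤n⇒2∣m-n (2∤m*n⇒2∤n A (2∤m*n⇒2∤m p 2∤Aq₁p)) (2∤m*n⇒2∤m q₁ (2∤m*n⇒2∤m p 2∤Aq₁p))
  where
  open ∣-Reasoning
  2∤Aq₁p : ¬ (+ 2 ∣ₛ A * q₁ * p)
  2∤Aq₁p = 2∣m-1⇒2∤m (*-cancelˡ-∣ (+ 4) (*-cancelˡ-∣ N (begin
    N * (+ 4 * + 2)                                       ≡⟨ solve (N ∷ []) ⟩
    + 8 * N                                               ∣⟨ ∣ᵤ⇒∣ B²≡D+4N ⟩
    B * B - (B * B - + 4 * A * (q₁ * (N * p)) + + 4 * N)  ≡⟨ solve (N ∷ A ∷ B ∷ p ∷ q₁ ∷ []) ⟩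
    N * (+ 4 * (A * q₁ * p - + 1))                        ∎)))

B²≡D⇒2∣v : ∀ N B D u v → ¬ (+ 2 ∣ₛ u) → ¬ (+ 2 ∣ₛ u - v * B) →
  B * B ≡ D [mod + 8 * N ] → D ≡ + 1 [mod + 8 ] → + 2 ∣ₛ v
B²≡D⇒2∣v N B D u v 2∤u 2∤u′ B²≡D D≡1 = 2∣m*n⇒2∤n⇒2∣m 2∣vB 2∤B
  where
  open ∣-Reasoning
  2∣8 : + 2 ∣ₛ + 8
  2∣8 = divides (+ 4) refl
  2∤D : ¬ (+ 2 ∣ₛ D)
  2∤D = 2∣m-1⇒2∤m (∣-trans 2∣8 (∣ᵤ⇒∣ {+ 8} {D - + 1} D≡1))
  2∣B²-D : + 2 ∣ₛ B * B - D
  2∣B²-D = ∣-trans (∣m⇒∣m*n N 2∣8) (∣ᵤ⇒∣ {+ 8 * N} {B * B - D} B²≡D)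
  2∤B : ¬ (+ 2 ∣ₛ B)
  2∤B 2∣B = 2∤D (begin
    + 2                  ∣⟨ ∣m∣n⇒∣m-n (∣m⇒∣m*n B 2∣B) 2∣B²-D ⟩
    B * B - (B * B - D)  ≡⟨ solve (B ∷ D ∷ []) ⟩
    D                    ∎)
  2∣vB : + 2 ∣ₛ v * B
  2∣vB = begin
    + 2              ∣⟨ 2∤m⇒2∤n⇒2∣m-n 2∤u 2∤u′ ⟩
    u - (u - v * B)  ≡⟨ solve (u ∷ v ∷ B ∷ []) ⟩
    v * B            ∎

4∣twoθ : ∀ N N₁ λN A B v v₁ A₁ u q₁ q₂ → ¬ (+ 2 ∣ₛ u - v * B) → + 2 ∣ₛ v * (q₁ - A) →
  + 4 ∣ₛ twoθ N N₁ λN A B v v₁ A₁ u q₁ q₂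
4∣twoθ N N₁ λN A B v v₁ A₁ u q₁ q₂ 2∤u′ 2∣v[q₁-A] =
  ∣m∣n⇒∣m+n (∣m∣n⇒∣m+n (*-monoʳ-∣ (+ 2) (2∣[N-1]vW (u - v * B) 2∤u′))
                       (2∣m⇒2∣n⇒4∣m*n 2∣6v₁A₁[N₁-1] (2∤m⇒2∣m-1 2∤u′)))
            (∣n⇒∣m*n (+ 3 * + λN) (2∤m⇒4∣m*m-1 2∤u′))
  where
  open ∣-Reasoning

  2∣[N-1]vW : ∀ u′ → ¬ (+ 2 ∣ₛ u′) →
    + 2 ∣ₛ (N - + 1) * v * (u′ * q₁ + A * (q₂ * (+ 1 - u′ * u′) - u′))
  2∣[N-1]vW u′ 2∤u′ = begin
    + 2
      ∣⟨ ∣n⇒∣m*n (N - + 1) (∣m∣n⇒∣m-n (∣n⇒∣m*n u′ 2∣v[q₁-A]) (∣n⇒∣m*n (v * A * q₂) 2∣u′²-1)) ⟩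
    (N - + 1) * (u′ * (v * (q₁ - A)) - v * A * q₂ * (u′ * u′ - + 1))
      ≡⟨ solve (N ∷ A ∷ v ∷ q₁ ∷ q₂ ∷ u′ ∷ []) ⟩
    (N - + 1) * v * (u′ * q₁ + A * (q₂ * (+ 1 - u′ * u′) - u′))
      ∎
    where
    2∣u′²-1 : + 2 ∣ₛ u′ * u′ - + 1
    2∣u′²-1 = ∣-trans (divides (+ 2) refl) (2∤m⇒4∣m*m-1 2∤u′)

  2∣6v₁A₁[N₁-1] : + 2 ∣ₛ + 6 * v₁ * A₁ * (N₁ - + 1)
  2∣6v₁A₁[N₁-1] = ∣m⇒∣m*n (N₁ - + 1) (∣m⇒∣m*n A₁ (∣m⇒∣m*n v₁ (divides (+ 3) refl)))

mainTheorem8 : ∀ (N N₁ : ℤ) (λN : ℕ) (D Δ : ℤ) (c : ℕ) (A B C u v v₁ A₁ q₁ q₂ : ℤ) →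
    + 1 < N → N ≡ + (2 ℕ.^ λN) * N₁ → Odd N₁ →
    D < + 0 → FundamentalDiscriminant Δ → 0 ℕ.< c → D ≡ + c * + c * Δ →
    + 0 < A → gcd (gcd A B) C ≡ + 1 → B * B - + 4 * A * C ≡ D →
    gcd A N ≡ + 1 → N ∣ C →
    let p = u * u - u * v * B + v * v * A * C in
    Prime ∣ p ∣ → ¬ (p ∣ + 6 * + c * N) → SplitsIn D p →
    p ∣ C → p ∣ u →
    IsOddPart v v₁ → IsOddPart A A₁ →
    C ≡ q₁ * (N * p) → u ≡ q₂ * p →
    Even N →
    (B * B ≡ D + + 4 * N [mod + 8 * N ]
      ⊎ (B * B ≡ D [mod + 8 * N ] × D ≡ + 1 [mod + 8 ])) →
    + 4 ∣ twoθ N N₁ λN A B v v₁ A₁ u q₁ q₂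
mainTheorem8 N N₁ λN D Δ c A B C u v v₁ A₁ q₁ q₂ 1<N _ _ _ _ _ _ _ _ B²-4AC≡D _ _
             p-prime p∤6cN _ _ _ _ _ C≡q₁Np _ 2∣N congruence =
  ∣⇒∣ᵤ (4∣twoθ N N₁ λN A B v v₁ A₁ u q₁ q₂ 2∤u′ 2∣v[q₁-A])
  where
  instance
    N≢0 : NonZero N
    N≢0 = >-nonZero (<-trans (+<+ (ℕ.s≤s ℕ.z≤n)) 1<N)
  2∣ₛN : + 2 ∣ₛ N
  2∣ₛN = ∣ᵤ⇒∣ 2∣N
  2∤p : ¬ (+ 2 ∣ₛ u * u - u * v * B + v * v * A * C)
  2∤p 2∣p = p∤6cN (even-prime∣even {u * u - u * v * B + v * v * A * C} {+ 6 * + c * N}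
                                    p-prime 2∣p (∣n⇒∣m*n (+ 6 * + c) 2∣ₛN))
  2∤u*u′ : ¬ (+ 2 ∣ₛ u * (u - v * B))
  2∤u*u′ = 2∤norm⇒2∤u*u′ u v A B C 2∣C 2∤p
    where
    2∣C : + 2 ∣ₛ C
    2∣C = subst (+ 2 ∣ₛ_) (sym C≡q₁Np) (∣n⇒∣m*n q₁ (∣m⇒∣m*n _ 2∣ₛN))
  2∤u′ : ¬ (+ 2 ∣ₛ u - v * B)
  2∤u′ = 2∤m*n⇒2∤n u 2∤u*u′
  2∣v[q₁-A] : + 2 ∣ₛ v * (q₁ - A)
  2∣v[q₁-A] = case congruence of λ where
    (inj₁ B²≡D+4N) → ∣n⇒∣m*n v (B²≡D+4N⇒2∣q₁-A N A B _ q₁ C≡q₁Np B²-4AC≡D B²≡D+4N)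
    (inj₂ (B²≡D , D≡1)) →
      ∣m⇒∣m*n (q₁ - A) (B²≡D⇒2∣v N B D u v (2∤m*n⇒2∤m {u} (u - v * B) 2∤u*u′) 2∤u′ B²≡D D≡1)
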